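{- Let $v>k>i\ge 0$ be integers with $v\ge 2k$ and $(v,k,i)\neq(2k,k,0)$, let $X=J(v,k,i)$ and $\Delta=v-2k+2i$. Let $A,B$ be vertices of $X$, $x=|A\cap B|$, and suppose there is a path from $A$ to $B$ of length $d$. If $d=2p$, then $p\ge\left\lceil\frac{k-x}{\Delta}\right\rceil$; if $d=2p+1$, then $p\ge\left\lceil\frac{x-i}{\Delta}\right\rceil$.
   Context: For integers $v>k>i\ge 0$, the generalized Johnson graph $J(v,k,i)$ is the simple undirected graph whose vertices are the $k$-element subsets of a fixed $v$-element set, two vertices $A,B$ being adjacent iff $|A\cap B|=i$. -}

module Defs where

open import Data.Nat using (ℕ; zero; suc; _+_; _*_; _∸_; _/_; pred)
open import Data.Nat.DivMod
open import Data.Bool using (Bool)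
open import Data.Fin.Subset using (Subset; _∩_; ∣_∣)
open import Data.Product using (Σ; _×_; _,_; proj₁)
open import Data.Vec using (Vec; []; _∷_)
open import Data.Unit using (⊤)
open import Relation.Binary.PropositionalEquality using (_≡_)

Vertex : ℕ → ℕ → Set
Vertex v k = Σ (Subset v) (λ S → ∣ S ∣ ≡ k)

meet : ∀ {v k} → Vertex v k → Vertex v k → ℕ
meet (S , _) (T , _) = ∣ S ∩ T ∣

Adj : (v k i : ℕ) → Vertex v k → Vertex v k → Set
Adj v k i A B = meet A B ≡ i

-- A walk (path in the paper's sense: sequence of adjacent vertices)
-- of length d from A to B in J(v,k,i).
data Walk (v k i : ℕ) : Vertex v k → Vertex v k → ℕ → Set where
  nil  : ∀ {A} → Walk v k i A A zero
  cons : ∀ {A B C d} → Adj v k i A B → Walk v k i B C d → Walk v k i A C (suc d)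

-- ceiling division ⌈ a / b ⌉ for b > 0 (value for b = 0 is irrelevant here).
ceilDiv : ℕ → ℕ → ℕ
ceilDiv a zero = zero
ceilDiv a (suc b) = (a + b) / suc b

-- Along an edge A — C of J(v,k,i), the sets A ∩ B and C ∩ B lie in B and meet
-- inside A ∩ C, so |A ∩ B| + |C ∩ B| ≤ k + i; and A ∪ B ∪ C fits in the v-set, so
-- inclusion–exclusion gives |A ∩ B| + |C ∩ B| ≥ 3k − v − i.  Hence one step
-- turns |A ∩ B| − i into at most k − |C ∩ B|, and turns k − |A ∩ B| into at most
-- Δ + (|C ∩ B| − i).  Peeling a walk edge by edge, k − x ≤ pΔ after 2p steps and
-- x − i ≤ pΔ after 2p + 1 steps.
module Submission where

open import Defs
open import Data.Nat using (ℕ; zero; suc; _+_; _*_; _∸_; _≤_; _<_; z≤n; s≤s; s≤s⁻¹)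
open import Data.Nat.Properties
open import Data.Nat.DivMod using (m<n*o⇒m/o<n)
open import Data.Nat.Solver using (module +-*-Solver)
open import Algebra.Properties.CommutativeSemigroup +-commutativeSemigroup using (xy∙z≈xz∙y)
open import Data.Fin.Subset using (Subset; _∩_; _∪_; _⊆_; ∣_∣; inside; outside)
open import Data.Fin.Subset.Properties
  using (p⊆q⇒∣p∣≤∣q∣; ∣p∣≤n; p∩q⊆p; p∩q⊆q; x∈p∩q⁺; x∈p∩q⁻; ∩-idem; ∩-distribʳ-∪)
open import Data.Vec using ([]; _∷_)
open import Data.Product using (_×_; _,_; proj₁; proj₂)
open import Data.Empty using (⊥-elim)
open import Relation.Binary.PropositionalEquality
open import Relation.Nullary using (¬_)

∣p∪q∣+∣p∩q∣≡∣p∣+∣q∣ : ∀ {n} (p q : Subset n) → ∣ p ∪ q ∣ + ∣ p ∩ q ∣ ≡ ∣ p ∣ + ∣ q ∣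
∣p∪q∣+∣p∩q∣≡∣p∣+∣q∣ []            []            = refl
∣p∪q∣+∣p∩q∣≡∣p∣+∣q∣ (inside  ∷ p) (inside  ∷ q) =
  cong suc (trans (+-suc _ _) (trans (cong suc (∣p∪q∣+∣p∩q∣≡∣p∣+∣q∣ p q)) (sym (+-suc _ _))))
∣p∪q∣+∣p∩q∣≡∣p∣+∣q∣ (inside  ∷ p) (outside ∷ q) = cong suc (∣p∪q∣+∣p∩q∣≡∣p∣+∣q∣ p q)
∣p∪q∣+∣p∩q∣≡∣p∣+∣q∣ (outside ∷ p) (inside  ∷ q) =
  trans (cong suc (∣p∪q∣+∣p∩q∣≡∣p∣+∣q∣ p q)) (sym (+-suc _ _))
∣p∪q∣+∣p∩q∣≡∣p∣+∣q∣ (outside ∷ p) (outside ∷ q) = ∣p∪q∣+∣p∩q∣≡∣p∣+∣q∣ p q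

∣p∪q∣≤∣p∣+∣q∣ : ∀ {n} (p q : Subset n) → ∣ p ∪ q ∣ ≤ ∣ p ∣ + ∣ q ∣
∣p∪q∣≤∣p∣+∣q∣ p q = ≤-trans (m≤m+n _ _) (≤-reflexive (∣p∪q∣+∣p∩q∣≡∣p∣+∣q∣ p q))

∩-mono-⊆ : ∀ {n} {p p′ q q′ : Subset n} → p ⊆ p′ → q ⊆ q′ → p ∩ q ⊆ p′ ∩ q′
∩-mono-⊆ {p = p} {q = q} p⊆p′ q⊆q′ x∈p∩q =
  x∈p∩q⁺ (p⊆p′ (proj₁ (x∈p∩q⁻ p q x∈p∩q)) , q⊆q′ (proj₂ (x∈p∩q⁻ p q x∈p∩q)))

∣p∩r∣+∣q∩r∣≤∣p∩q∣+∣r∣ : ∀ {n} (p q r : Subset n) → ∣ p ∩ r ∣ + ∣ q ∩ r ∣ ≤ ∣ p ∩ q ∣ + ∣ r ∣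
∣p∩r∣+∣q∩r∣≤∣p∩q∣+∣r∣ {n} p q r = begin
  ∣ p ∩ r ∣ + ∣ q ∩ r ∣                           ≡⟨ ∣p∪q∣+∣p∩q∣≡∣p∣+∣q∣ (p ∩ r) (q ∩ r) ⟨
  ∣ (p ∩ r) ∪ (q ∩ r) ∣ + ∣ (p ∩ r) ∩ (q ∩ r) ∣  ≡⟨ cong (λ (s : Subset n) → ∣ s ∣ + ∣ (p ∩ r) ∩ (q ∩ r) ∣) (∩-distribʳ-∪ r p q) ⟨
  ∣ (p ∪ q) ∩ r ∣ + ∣ (p ∩ r) ∩ (q ∩ r) ∣         ≤⟨ +-mono-≤ (p⊆q⇒∣p∣≤∣q∣ (p∩q⊆q (p ∪ q) r))
                                                               (p⊆q⇒∣p∣≤∣q∣ (∩-mono-⊆ (p∩q⊆p p r) (p∩q⊆p q r))) ⟩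
  ∣ r ∣ + ∣ p ∩ q ∣                               ≡⟨ +-comm ∣ r ∣ (∣ p ∩ q ∣) ⟩
  ∣ p ∩ q ∣ + ∣ r ∣                               ∎
  where open ≤-Reasoning

∣p∣+∣q∣+∣r∣≤n+[∣p∩r∣+∣q∩r∣]+∣p∩q∣ : ∀ {n} (p q r : Subset n) →
  ∣ p ∣ + ∣ q ∣ + ∣ r ∣ ≤ n + (∣ p ∩ r ∣ + ∣ q ∩ r ∣) + ∣ p ∩ q ∣
∣p∣+∣q∣+∣r∣≤n+[∣p∩r∣+∣q∩r∣]+∣p∩q∣ {n} p q r = begin
  ∣ p ∣ + ∣ q ∣ + ∣ r ∣                                ≡⟨ cong (_+ ∣ r ∣) (∣p∪q∣+∣p∩q∣≡∣p∣+∣q∣ p q) ⟨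
  ∣ p ∪ q ∣ + ∣ p ∩ q ∣ + ∣ r ∣                        ≡⟨ xy∙z≈xz∙y ∣ p ∪ q ∣ (∣ p ∩ q ∣) (∣ r ∣) ⟩
  ∣ p ∪ q ∣ + ∣ r ∣ + ∣ p ∩ q ∣                        ≡⟨ cong (_+ ∣ p ∩ q ∣) (∣p∪q∣+∣p∩q∣≡∣p∣+∣q∣ (p ∪ q) r) ⟨
  ∣ (p ∪ q) ∪ r ∣ + ∣ (p ∪ q) ∩ r ∣ + ∣ p ∩ q ∣        ≡⟨ cong (λ (s : Subset n) → ∣ (p ∪ q) ∪ r ∣ + ∣ s ∣ + ∣ p ∩ q ∣) (∩-distribʳ-∪ r p q) ⟩
  ∣ (p ∪ q) ∪ r ∣ + ∣ (p ∩ r) ∪ (q ∩ r) ∣ + ∣ p ∩ q ∣  ≤⟨ +-monoˡ-≤ ∣ p ∩ q ∣ (+-mono-≤ (∣p∣≤n ((p ∪ q) ∪ r))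
                                                                            (∣p∪q∣≤∣p∣+∣q∣ (p ∩ r) (q ∩ r))) ⟩
  n + (∣ p ∩ r ∣ + ∣ q ∩ r ∣) + ∣ p ∩ q ∣              ∎
  where open ≤-Reasoning

m≤n*o⇒ceilDiv≤n : ∀ m n o → m ≤ n * o → ceilDiv m o ≤ n
m≤n*o⇒ceilDiv≤n m n zero    _ = z≤n
m≤n*o⇒ceilDiv≤n m n (suc o) m≤n*o = s≤s⁻¹ (m<n*o⇒m/o<n {m + o} {suc n} {suc o} m+o<[1+n]*[1+o])
  where
  m+o<[1+n]*[1+o] : m + o < suc n * suc o
  m+o<[1+n]*[1+o] = s≤s (≤-trans (+-monoˡ-≤ o m≤n*o) (≤-reflexive (+-comm (n * suc o) o)))

suc≡2*suc⇒≡2*+1 : ∀ {d} p → suc d ≡ 2 * suc p → d ≡ 2 * p + 1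
suc≡2*suc⇒≡2*+1 {d} p eq = begin
  d                 ≡⟨ suc-injective eq ⟩
  p + suc (p + 0)   ≡⟨ +-suc p (p + 0) ⟩
  suc (2 * p)       ≡⟨ +-comm 1 (2 * p) ⟩
  2 * p + 1         ∎
  where open ≡-Reasoning

suc≡2*+1⇒≡2* : ∀ {d} p → suc d ≡ 2 * p + 1 → d ≡ 2 * p
suc≡2*+1⇒≡2* p eq = suc-injective (trans eq (+-comm (2 * p) 1))

module _ (v k i : ℕ) where

  Δ : ℕ
  Δ = v ∸ 2 * k + 2 * i

  meet-self : (A : Vertex v k) → meet A A ≡ k
  meet-self (S , ∣S∣≡k) = trans (cong ∣_∣ (∩-idem S)) ∣S∣≡k

  meet-step-odd : (A C B : Vertex v k) → Adj v k i A C →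
                  meet A B ∸ i ≤ k ∸ meet C B
  meet-step-odd (S , _) (T , _) (U , ∣U∣≡k) S∩T≡i = begin
    x ∸ i                  ≤⟨ ∸-monoˡ-≤ i (m+n≤o⇒m≤o∸n x x+y≤i+k) ⟩
    (i + k) ∸ y ∸ i        ≡⟨ ∸-+-assoc (i + k) y i ⟩
    (i + k) ∸ (y + i)      ≡⟨ cong ((i + k) ∸_) (+-comm y i) ⟩
    (i + k) ∸ (i + y)      ≡⟨ [m+n]∸[m+o]≡n∸o i k y ⟩
    k ∸ y                  ∎
    where
    open ≤-Reasoning
    x = ∣ S ∩ U ∣
    y = ∣ T ∩ U ∣
    x+y≤i+k : x + y ≤ i + k
    x+y≤i+k = subst₂ (λ a b → x + y ≤ a + b) S∩T≡i ∣U∣≡k (∣p∩r∣+∣q∩r∣≤∣p∩q∣+∣r∣ S T U)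

  meet-step-even : 2 * k ≤ v → (A C B : Vertex v k) → Adj v k i A C →
                   k ∸ meet A B ≤ Δ + (meet C B ∸ i)
  meet-step-even 2k≤v (S , ∣S∣≡k) (T , ∣T∣≡k) (U , ∣U∣≡k) S∩T≡i =
    m≤n+o⇒m∸n≤o k x (+-cancelˡ-≤ (2 * k) _ _ 2k+k≤2k+[x+Δ+j])
    where
    open ≤-Reasoning
    open +-*-Solver
    x = ∣ S ∩ U ∣
    y = ∣ T ∩ U ∣
    e = v ∸ 2 * k
    j = y ∸ i
    3k≤v+[x+y]+i : k + k + k ≤ v + (x + y) + i
    3k≤v+[x+y]+i = subst₂ (λ a b → a ≤ v + (x + y) + b)
      (cong₂ _+_ (cong₂ _+_ ∣S∣≡k ∣T∣≡k) ∣U∣≡k) S∩T≡i (∣p∣+∣q∣+∣r∣≤n+[∣p∩r∣+∣q∩r∣]+∣p∩q∣ S T U)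
    2k+k≤2k+[x+Δ+j] : 2 * k + k ≤ 2 * k + (x + (Δ + j))
    2k+k≤2k+[x+Δ+j] = begin
      2 * k + k                  ≡⟨ solve 1 (λ k → con 2 :* k :+ k := k :+ k :+ k) refl k ⟩
      k + k + k                  ≤⟨ 3k≤v+[x+y]+i ⟩
      v + (x + y) + i            ≤⟨ +-monoˡ-≤ i (+-mono-≤ (≤-reflexive (sym (m∸n+n≡m 2k≤v)))
                                                           (+-monoʳ-≤ x (m≤n+m∸n y i))) ⟩
      e + 2 * k + (x + (i + j)) + i ≡⟨ solve 5 (λ e k x i j → e :+ con 2 :* k :+ (x :+ (i :+ j)) :+ i
                                                          := con 2 :* k :+ (x :+ (e :+ con 2 :* i :+ j)))
                                             refl e k x i j ⟩
      2 * k + (x + (Δ + j))      ∎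

  mutual
    meet-walk-even : 2 * k ≤ v → ∀ {A B d} p → Walk v k i A B d → d ≡ 2 * p →
                     k ∸ meet A B ≤ p * Δ
    meet-walk-even _ {A} p nil _ =
      ≤-trans (≤-reflexive (trans (cong (k ∸_) (meet-self A)) (n∸n≡0 k))) z≤n
    meet-walk-even 2k≤v {A} {B} (suc p) (cons {B = C} A~C w) eq =
      ≤-trans (meet-step-even 2k≤v A C B A~C)
              (+-monoʳ-≤ Δ (meet-walk-odd 2k≤v p w (suc≡2*suc⇒≡2*+1 p eq)))

    meet-walk-odd : 2 * k ≤ v → ∀ {A B d} p → Walk v k i A B d → d ≡ 2 * p + 1 →
                    meet A B ∸ i ≤ p * Δ
    meet-walk-odd _ p nil eq = ⊥-elim (0≢1+n (trans eq (+-comm (2 * p) 1)))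
    meet-walk-odd 2k≤v {A} {B} p (cons {B = C} A~C w) eq =
      ≤-trans (meet-step-odd A C B A~C) (meet-walk-even 2k≤v p w (suc≡2*+1⇒≡2* p eq))

lemma3p2 : (v k i : ℕ) → i < k → k < v → 2 * k ≤ v →
    ¬ ((v ≡ 2 * k) × (i ≡ 0)) →
    (A B : Vertex v k) (d : ℕ) → Walk v k i A B d →
    ((p : ℕ) → d ≡ 2 * p →
    ceilDiv (k ∸ meet A B) (v ∸ 2 * k + 2 * i) ≤ p)
    × ((p : ℕ) → d ≡ 2 * p + 1 →
    ceilDiv (meet A B ∸ i) (v ∸ 2 * k + 2 * i) ≤ p)
lemma3p2 v k i _ _ 2k≤v _ _ _ _ w =
    (λ p eq → m≤n*o⇒ceilDiv≤n _ p _ (meet-walk-even v k i 2k≤v p w eq))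
  , (λ p eq → m≤n*o⇒ceilDiv≤n _ p _ (meet-walk-odd v k i 2k≤v p w eq))
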